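{- Let $G$ be the graph obtained from the dodecahedron graph by replacing every edge with a path of length $15$ (i.e. subdividing every edge into $15$ edges). Then $C(G)=3$, and $G$ admits a representation as a geometric graph.
   Context: The game of cops and robbers on a finite simple undirected graph $G$: first each of a finite set of cops is placed on a vertex, then the robber is placed on a vertex; in each subsequent step each cop, and then the robber, either moves to an adjacent vertex or stays. The cops win if at some step a cop occupies the robber's vertex. The cop number $C(G)$ is the minimum number of cops that can guarantee capturing the robber in finitely many steps. A geometric graph with parameter $r>0$ is a drawing of a graph whose vertex set is a finite set $V$ of points in the plane and whose edges are exactly the straight line segments between all pairs of distinct points of $V$ at Euclidean distance at most $r$; a graph admits a geometric representation if it is isomorphic to some geometric graph. -}

module Defs where

open import Data.Nat using (ℕ; zero; suc; _<_)
open import Data.Fin using (Fin; zero; suc; toℕ)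
open import Data.Vec using (Vec; []; _∷_; lookup)
open import Data.Vec.Membership.Propositional using (_∈_)
open import Data.Vec.Relation.Binary.Pointwise.Inductive using (Pointwise)
open import Data.Product using (Σ; ∃; _×_; _,_; proj₁; proj₂)
open import Data.Sum using (_⊎_)
open import Data.Empty using (⊥)
open import Relation.Nullary using (¬_)
open import Relation.Binary.PropositionalEquality using (_≡_; _≢_)
open import Function.Bundles using (_⇔_)
open import Data.Rational using (ℚ; 0ℚ) renaming (_+_ to _+ℚ_; _*_ to _*ℚ_; _-_ to _-ℚ_; _≤_ to _≤ℚ_; _<_ to _<ℚ_)

-- Simple undirected graphs: a vertex type with a symmetric, irreflexive
-- adjacency relation.  (Finiteness of the concrete graph below is evident
-- from its vertex type.)

record Graph : Set₁ where
  field
    Vertex : Set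
    Adj    : Vertex → Vertex → Set
    sym    : ∀ {x y} → Adj x y → Adj y x
    irrefl : ∀ {x} → ¬ Adj x x

module _ (G : Graph) where
  open Graph G

  Move : Vertex → Vertex → Set
  Move x y = x ≡ y ⊎ Adj x y

  Caught : ∀ {k} → Vec Vertex k → Vertex → Set
  Caught cs r = r ∈ cs

  -- CopsWinWithin m cs r : it is the cops' turn, cops are at cs, robber at r,
  -- and the cops can force a capture within m further rounds.
  CopsWinWithin : ∀ {k} → ℕ → Vec Vertex k → Vertex → Set
  CopsWinWithin {k} zero    cs r = Caught cs r
  CopsWinWithin {k} (suc m) cs r =
    Caught cs r ⊎
    Σ (Vec Vertex k) λ cs' → Pointwise Move cs cs' ×
      (Caught cs' r ⊎ (∀ r' → Move r r' → CopsWinWithin m cs' r'))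

  CopsWin : ℕ → Set
  CopsWin k = Σ (Vec Vertex k) λ cs → ∃ λ m → ∀ r → CopsWinWithin m cs r

  CopNumberIs : ℕ → Set
  CopNumberIs c = CopsWin c × (∀ k → k < c → ¬ CopsWin k)

-- Geometric graphs.  Points have rational coordinates; the condition
-- dist ≤ r is expressed as dist² ≤ r², with s = r² > 0 rational.

Point : Set
Point = ℚ × ℚ

dist² : Point → Point → ℚ
dist² (a , b) (c , d) = ((a -ℚ c) *ℚ (a -ℚ c)) +ℚ ((b -ℚ d) *ℚ (b -ℚ d))

module _ (G : Graph) where
  open Graph G

  HasGeometricRepresentation : Set
  HasGeometricRepresentation =
    Σ (Vertex → Point) λ f →
    Σ ℚ λ s →
      (0ℚ <ℚ s) ×
      (∀ x y → f x ≡ f y → x ≡ y) ×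
      (∀ x y → x ≢ y → (Adj x y ⇔ (dist² (f x) (f y) ≤ℚ s)))

-- Subdivision: every edge of a graph on Fin n with edge list E (m edges)
-- is replaced by a path with k internal vertices (i.e. of length k+1).

data SubVertex (n m k : ℕ) : Set where
  orig : Fin n → SubVertex n m k
  mid  : Fin m → Fin k → SubVertex n m k

module _ {n m k : ℕ} (E : Vec (Fin n × Fin n) m) where

  data SubStep : SubVertex n m k → SubVertex n m k → Set where
    first : ∀ e (i : Fin k) → toℕ i ≡ 0 →
            SubStep (orig (proj₁ (lookup E e))) (mid e i)
    next  : ∀ e (i j : Fin k) → toℕ j ≡ suc (toℕ i) →
            SubStep (mid e i) (mid e j)
    last  : ∀ e (i : Fin k) → suc (toℕ i) ≡ k →
            SubStep (mid e i) (orig (proj₂ (lookup E e)))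

  SubAdj : SubVertex n m k → SubVertex n m k → Set
  SubAdj x y = SubStep x y ⊎ SubStep y x

-- The dodecahedron: outer 5-cycle 0..4, middle 10-cycle 5..14,
-- inner 5-cycle 15..19; i ~ 5+2i and 6+2i ~ 15+i.

dodecaEdges : Vec (Fin 20 × Fin 20) 30
dodecaEdges =
  (# 0 , # 1) ∷ (# 1 , # 2) ∷ (# 2 , # 3) ∷ (# 3 , # 4) ∷ (# 4 , # 0) ∷
  (# 0 , # 5) ∷ (# 1 , # 7) ∷ (# 2 , # 9) ∷ (# 3 , # 11) ∷ (# 4 , # 13) ∷
  (# 5 , # 6) ∷ (# 6 , # 7) ∷ (# 7 , # 8) ∷ (# 8 , # 9) ∷ (# 9 , # 10) ∷
  (# 10 , # 11) ∷ (# 11 , # 12) ∷ (# 12 , # 13) ∷ (# 13 , # 14) ∷ (# 14 , # 5) ∷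
  (# 6 , # 15) ∷ (# 8 , # 16) ∷ (# 10 , # 17) ∷ (# 12 , # 18) ∷ (# 14 , # 19) ∷
  (# 15 , # 16) ∷ (# 16 , # 17) ∷ (# 17 , # 18) ∷ (# 18 , # 19) ∷ (# 19 , # 15) ∷ []
  where open import Data.Fin using (#_)

-- Dodecahedron with every edge replaced by a path of length 15
-- (14 internal vertices per edge).
G₁₅ : Graph
G₁₅ = record
  { Vertex = SubVertex 20 30 14
  ; Adj    = SubAdj dodecaEdges
  ; sym    = Data.Sum.swap
  ; irrefl = irr
  }
  where
  import Data.Sum
  import Data.Nat.Properties
  stepIrr : ∀ {x} → ¬ SubStep dodecaEdges x x
  noSuc : ∀ {a : ℕ} → a ≡ suc a → ⊥
  noSuc {zero} ()
  noSuc {suc a} p = noSuc {a} (Data.Nat.Properties.suc-injective p)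
  stepIrr (next e i .i p) = noSuc p
  irr : ∀ {x} → ¬ SubAdj dodecaEdges x x
  irr (Data.Sum.inj₁ s) = stepIrr s
  irr (Data.Sum.inj₂ s) = stepIrr s

{-# OPTIONS --safe #-}
module Submission where

-- Lower bound: the 20 branch vertices are 15 apart and the dodecahedron has girth 5, so a cop
-- that is not on a branch vertex w is within 15 of at most one of the three branch vertices
-- adjacent to w.  A robber standing on w can therefore always run along a subdivided edge to a
-- neighbouring branch vertex that neither cop can reach first; he starts on one of three branch
-- vertices no two of which a single cop can be close to.
-- Upper bound: two cops guard two geodesics of length 75, each keeping to the robber's "shadow"
-- (his distance from the start of the geodesic), so that stepping onto either geodesic is fatal.
-- The remaining vertices form a forest of depth at most 89 hanging off guarded branch vertices;
-- the third cop walks to the root of the robber's tree and chases him down it.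
-- The unit-disk drawing is explicit.

open import Defs

open import Data.Bool using (true; false; if_then_else_)
open import Data.Empty using (⊥-elim)
open import Data.Fin using (Fin; #_; zero; suc; toℕ; _≟_; inject₁; fromℕ; fromℕ<)
open import Data.Fin.Properties using (all?; toℕ-injective; toℕ-inject₁; toℕ-fromℕ)
open import Data.Integer as ℤ using (+_; -[1+_]; _⊖_)
import Data.Integer.Properties as ℤ
open import Data.Integer.Solver using () renaming (module +-*-Solver to ℤ-Solver)
open import Data.List as List using (List; []; _∷_; [_]; _++_; concatMap; allFin; length; filter)
open import Data.List.Properties using (filter-none)
import Data.List.Relation.Unary.All as LAll
import Data.List.Relation.Unary.Any as LAny
open import Data.List.Relation.Unary.AllPairs as AllPairs using (AllPairs; []; _∷_; allPairs?)
open import Data.List.Relation.Unary.Linked using (Linked; [-]; _∷_; linked?)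
open import Data.Maybe using (fromMaybe)
import Data.Nat as ℕ
open import Data.Nat using (ℕ; zero; suc; pred; _+_; _*_; _∸_; _⊓_; _⊓′_; _≤_; _<_; _≤′_; ≤′-refl; ≤′-step;
                            z≤n; s≤s; _≤?_; _<?_)
open import Data.Nat.Properties
  using (≤-refl; ≤-reflexive; ≤-trans; ≤-antisym; ≤-pred; <-irrefl; <-cmp; <⇒≤; <⇒≱; ≰⇒>; ≤∧≢⇒<; ≤⇒≤′;
         n≤1+n; n≤0⇒n≡0; pred-mono-≤; suc-injective; +-identityʳ; +-suc; +-mono-≤; +-monoʳ-≤; +-cancelʳ-≡;
         +-∸-assoc; m∸n≤m; m+[n∸m]≡n; n∸n≡0; m≤n⇒m∸n≡0; ⊓-mono-≤; m⊓n≤n; m≤n⇒m⊓n≡m; m≥n⇒m⊓n≡n;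
         module ≤-Reasoning)
import Data.Nat.Coprimality as Coprime
open import Data.Nat.GeneralisedArithmetic using (iterate; iterate-is-fold)
open import Data.Product using (∃-syntax; _×_; _,_; proj₁; proj₂)
open import Data.Rational as ℚ using (ℚ; mkℚ; toℚᵘ) renaming (_≤_ to _≤ℚ_)
import Data.Rational.Properties as ℚ
open import Data.Rational.Unnormalised as ℚᵘ using (ℚᵘ)
import Data.Rational.Unnormalised.Properties as ℚᵘ
open import Data.Sum using (_⊎_; inj₁; inj₂; swap)
open import Data.Vec using (Vec; []; _∷_; lookup)
open import Data.Vec.Relation.Binary.Pointwise.Inductive using (Pointwise; []; _∷_)
open import Data.Vec.Relation.Unary.All as All using (All; []; _∷_)
open import Data.Vec.Relation.Unary.Any using (here; there)
open import Function using (_∘_; _⇔_; mk⇔; Equivalence)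
open import Relation.Binary.Definitions using (DecidableEquality; tri<; tri≈; tri>)
import Relation.Binary.Definitions as B
open import Relation.Binary.PropositionalEquality
  using (_≡_; _≢_; refl; sym; trans; cong; cong₂; subst; subst₂; module ≡-Reasoning)
open import Relation.Nullary using (¬_; ¬?; Dec; yes; no)
open import Relation.Nullary.Decidable using (does; map′; _×-dec_; _⊎-dec_; _→-dec_)
import Relation.Unary as U

-- Cops and robbers on an arbitrary graph

module Game (G : Graph) where
  open Graph G renaming (sym to Adj-sym)

  Move-sym : ∀ {x y} → Move G x y → Move G y x
  Move-sym (inj₁ refl) = inj₁ refl
  Move-sym (inj₂ a)    = inj₂ (Adj-sym a)

  CopsWinWithin-caught : ∀ {k} m {cs : Vec Vertex k} {r} → Caught G cs r → CopsWinWithin G m cs r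
  CopsWinWithin-caught zero    c = c
  CopsWinWithin-caught (suc m) c = inj₁ c

  CopsWinWithin-∷ : ∀ {k} m c {cs : Vec Vertex k} {r} →
                    CopsWinWithin G m cs r → CopsWinWithin G m (c ∷ cs) r
  CopsWinWithin-∷ zero    c w                          = there w
  CopsWinWithin-∷ (suc m) c (inj₁ caught)              = inj₁ (there caught)
  CopsWinWithin-∷ (suc m) c (inj₂ (cs′ , mv , inj₁ w)) = inj₂ (c ∷ cs′ , inj₁ refl ∷ mv , inj₁ (there w))
  CopsWinWithin-∷ (suc m) c (inj₂ (cs′ , mv , inj₂ w)) =
    inj₂ (c ∷ cs′ , inj₁ refl ∷ mv , inj₂ λ r′ m′ → CopsWinWithin-∷ m c (w r′ m′))

  CopsWin-suc : ∀ {k} → Vertex → CopsWin G k → CopsWin G (suc k)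
  CopsWin-suc c (cs , m , w) = c ∷ cs , m , λ r → CopsWinWithin-∷ m c (w r)

  ¬CopsWin-≤ : ∀ {k n} → Vertex → ¬ CopsWin G n → k ≤ n → ¬ CopsWin G k
  ¬CopsWin-≤ v lose k≤n = go (≤⇒≤′ k≤n) lose
    where
    go : ∀ {k n} → k ≤′ n → ¬ CopsWin G n → ¬ CopsWin G k
    go ≤′-refl       lose = lose
    go (≤′-step k≤n) lose = go k≤n (lose ∘ CopsWin-suc v)

  copNumber : ∀ {n} → Vertex → CopsWin G (suc n) → ¬ CopsWin G n → CopNumberIs G (suc n)
  copNumber v win lose = win , λ k k<1+n → ¬CopsWin-≤ v lose (≤-pred k<1+n)

-- The robber heads for a target t.  Safe n t says he is within n of it while every cop is at
-- least n + 2 away, so he gets there first; from a target he escapes to a new safe position.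

module Evasion (G : Graph) {T : Set} (dist : T → Graph.Vertex G → ℕ) where
  open Graph G using (Vertex)

  Safe : ∀ {k} → ℕ → T → Vec Vertex k → Vertex → Set
  Safe n t cs r = dist t r ≤ n × All (λ c → 2 + n ≤ dist t c) cs

  not-caught : ∀ {j n t r} {cs : Vec Vertex j} →
               dist t r ≤ n → All (λ c → suc n ≤ dist t c) cs → ¬ Caught G cs r
  not-caught r≤n (c>n ∷ _)   (here refl)  = <-irrefl refl (≤-trans c>n r≤n)
  not-caught r≤n (_ ∷ cs>n)  (there r∈cs) = not-caught r≤n cs>n r∈cs

  module _
    (lipschitz : ∀ t {x y} → Move G x y → dist t x ≤ suc (dist t y))
    (approach : ∀ t {n} x → dist t x ≤ suc n → ∃[ y ] Move G x y × dist t y ≤ n)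
    {k : ℕ}
    (escape : ∀ t r (cs : Vec Vertex k) → dist t r ≡ 0 → All (λ c → 1 ≤ dist t c) cs →
              ∃[ n ] ∃[ t′ ] ∃[ r′ ] Move G r r′ × Safe n t′ cs r′)
    (start : ∀ (cs : Vec Vertex k) → ∃[ t ] ∃[ r ] Safe 0 t cs r)
    where

    cops-move : ∀ {j n t} {cs cs′ : Vec Vertex j} → Pointwise (Move G) cs cs′ →
                All (λ c → suc (suc n) ≤ dist t c) cs → All (λ c → suc n ≤ dist t c) cs′
    cops-move []                   []           = []
    cops-move {t = t} (mv ∷ mvs) (c>n ∷ cs>n) = ≤-pred (≤-trans c>n (lipschitz t mv)) ∷ cops-move mvs cs>n

    evade : ∀ m n t (cs : Vec Vertex k) r → Safe n t cs r → ¬ CopsWinWithin G m cs r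
    evade zero    n t cs r (r≤n , cs>n) c        = not-caught r≤n (All.map <⇒≤ cs>n) c
    evade (suc m) n t cs r (r≤n , cs>n) (inj₁ c) = not-caught r≤n (All.map <⇒≤ cs>n) c
    evade (suc m) n t cs r (r≤n , cs>n) (inj₂ (cs′ , mvs , inj₁ c)) = not-caught r≤n (cops-move mvs cs>n) c
    evade (suc m) (suc n) t cs r (r≤n , cs>n) (inj₂ (cs′ , mvs , inj₂ w)) with approach t r r≤n
    ... | r′ , mv , r′≤n = evade m n t cs′ r′ (r′≤n , cops-move mvs cs>n) (w r′ mv)
    evade (suc m) zero t cs r (r≤0 , cs>0) (inj₂ (cs′ , mvs , inj₂ w))
      with escape t r cs′ (n≤0⇒n≡0 r≤0) (cops-move mvs cs>0)
    ... | n , t′ , r′ , mv , safe = evade m n t′ cs′ r′ safe (w r′ mv)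

    robber-wins : ¬ CopsWin G k
    robber-wins (cs , m , w) with start cs
    ... | t , r , safe = evade m 0 t cs r safe (w r)

-- A cop on the walk path follows the robber's shadow f r ⊓ ℓ.  Shadowing t c r: the cop at
-- index c is at most one step past the shadow and is either within one step of it or still
-- catching up, which he does within t rounds.  Once settled he moves onto the shadow each
-- round, so a robber standing on path (shadow r) is captured.

module Shadowing (G : Graph) (ℓ : ℕ) (path : ℕ → Graph.Vertex G)
                 (path-move : ∀ i → Move G (path i) (path (suc i)))
                 (f : Graph.Vertex G → ℕ)
                 (f-lipschitz : ∀ {x y} → Move G x y → f x ≤ suc (f y)) where
  open Graph G using (Vertex)
  open Game G using (Move-sym)

  shadow : Vertex → ℕ
  shadow r = f r ⊓ ℓ

  nextIndex : ℕ → Vertex → ℕ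
  nextIndex c r = shadow r ⊓ suc c

  record Shadowing (t c : ℕ) (r : Vertex) : Set where
    constructor shadowing
    field
      not-past        : c ≤ suc (shadow r)
      near-or-in-time : shadow r ≤ suc c ⊎ ℓ ≤ c + t

  path-move-near : ∀ {i j} → i ≤ suc j → j ≤ suc i → Move G (path i) (path j)
  path-move-near {i} {j} i≤1+j j≤1+i with <-cmp i j
  ... | tri< i<j _ _  = subst (λ k → Move G (path i) (path k)) (≤-antisym i<j j≤1+i) (path-move i)
  ... | tri≈ _ refl _ = inj₁ refl
  ... | tri> _ _ j<i  = subst (λ k → Move G (path k) (path j)) (≤-antisym j<i i≤1+j) (Move-sym (path-move j))

  shadow-lipschitz : ∀ {r r′} → Move G r r′ → shadow r ≤ suc (shadow r′)
  shadow-lipschitz mv = ⊓-mono-≤ (f-lipschitz mv) (n≤1+n ℓ)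

  arrived⇒shadow≤1+c : ∀ {c} r → ℓ ≤ c + 0 → shadow r ≤ suc c
  arrived⇒shadow≤1+c {c} r ℓ≤c+0 = begin
    f r ⊓ ℓ ≤⟨ m⊓n≤n (f r) ℓ ⟩
    ℓ       ≤⟨ ℓ≤c+0 ⟩
    c + 0   ≡⟨ +-identityʳ c ⟩
    c       ≤⟨ n≤1+n c ⟩
    suc c   ∎
    where open ≤-Reasoning

  nextIndex-cases : ∀ c r → (shadow r ≤ suc c × nextIndex c r ≡ shadow r)
                          ⊎ (suc c < shadow r × nextIndex c r ≡ suc c)
  nextIndex-cases c r with shadow r ≤? suc c
  ... | yes s≤1+c = inj₁ (s≤1+c , m≤n⇒m⊓n≡m s≤1+c)
  ... | no  s≰1+c = inj₂ (≰⇒> s≰1+c , m≥n⇒m⊓n≡n (<⇒≤ (≰⇒> s≰1+c)))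

  shadowing-start : ∀ r → Shadowing ℓ 0 r
  shadowing-start r = shadowing z≤n (inj₂ ≤-refl)

  shadowing-move : ∀ {t c r} → Shadowing t c r → Move G (path c) (path (nextIndex c r))
  shadowing-move {c = c} {r} (shadowing c≤1+s _) with nextIndex-cases c r
  ... | inj₁ (s≤1+c , eq) rewrite eq = path-move-near c≤1+s s≤1+c
  ... | inj₂ (_     , eq) rewrite eq = path-move c

  shadowing-step : ∀ {t c r r′} → Shadowing t c r → Move G r r′ → Shadowing (pred t) (nextIndex c r) r′
  shadowing-step {t} {c} {r} (shadowing c≤1+s near-or-in-time) mv with nextIndex-cases c r
  ... | inj₁ (s≤1+c , eq) rewrite eq =
    shadowing (shadow-lipschitz mv) (inj₁ (shadow-lipschitz (Move-sym mv)))
  ... | inj₂ (1+c<s , eq) rewrite eq =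
    shadowing (≤-trans (<⇒≤ 1+c<s) (shadow-lipschitz mv)) (inj₂ (in-time t near-or-in-time))
    where
    in-time : ∀ t → shadow r ≤ suc c ⊎ ℓ ≤ c + t → ℓ ≤ suc c + pred t
    in-time _       (inj₁ s≤1+c)   = ⊥-elim (<⇒≱ 1+c<s s≤1+c)
    in-time zero    (inj₂ ℓ≤c+0)   = ⊥-elim (<⇒≱ 1+c<s (arrived⇒shadow≤1+c r ℓ≤c+0))
    in-time (suc t) (inj₂ ℓ≤c+1+t) = ≤-trans ℓ≤c+1+t (≤-reflexive (+-suc c t))

  shadowing-settled : ∀ {c r} → Shadowing 0 c r → nextIndex c r ≡ shadow r
  shadowing-settled (shadowing _ (inj₁ s≤1+c))           = m≤n⇒m⊓n≡m s≤1+c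
  shadowing-settled {r = r} (shadowing _ (inj₂ ℓ≤c+0)) = m≤n⇒m⊓n≡m (arrived⇒shadow≤1+c r ℓ≤c+0)

module Forest (G : Graph) (parent : Graph.Vertex G → Graph.Vertex G) (depth : Graph.Vertex G → ℕ)
              (parent-adj : ∀ x → 0 < depth x → Graph.Adj G x (parent x))
              (parent-depth : ∀ x → 0 < depth x → suc (depth (parent x)) ≡ depth x) where
  open Graph G using (Vertex; Adj)

  -- The ancestor of x at depth k (x itself when k ≥ depth x).
  ancestor : ℕ → Vertex → Vertex
  ancestor k x = iterate parent x (depth x ∸ k)

  iterate-suc : ∀ j x → iterate parent x (suc j) ≡ parent (iterate parent x j)
  iterate-suc j x = trans (sym (iterate-is-fold x parent (suc j))) (cong parent (iterate-is-fold x parent j))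

  depth-iterate : ∀ j x → j ≤ depth x → depth (iterate parent x j) + j ≡ depth x
  depth-iterate zero    x _     = +-identityʳ (depth x)
  depth-iterate (suc j) x 1+j≤d = begin
    depth (iterate parent (parent x) j) + suc j   ≡⟨ +-suc _ j ⟩
    suc (depth (iterate parent (parent x) j) + j) ≡⟨ cong suc (depth-iterate j (parent x) j≤d′) ⟩
    suc (depth (parent x))                        ≡⟨ pd ⟩
    depth x                                       ∎
    where
    open ≡-Reasoning
    pd : suc (depth (parent x)) ≡ depth x
    pd = parent-depth x (≤-trans (s≤s z≤n) 1+j≤d)
    j≤d′ : j ≤ depth (parent x)
    j≤d′ = ≤-pred (≤-trans 1+j≤d (≤-reflexive (sym pd)))

  depth-ancestor : ∀ {k x} → k ≤ depth x → depth (ancestor k x) ≡ k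
  depth-ancestor {k} {x} k≤d = +-cancelʳ-≡ (depth x ∸ k) _ _
    (trans (depth-iterate (depth x ∸ k) x (m∸n≤m (depth x) k)) (sym (m+[n∸m]≡n k≤d)))

  ancestor-self : ∀ {k x} → depth x ≡ k → ancestor k x ≡ x
  ancestor-self {k} {x} refl = cong (iterate parent x) (n∸n≡0 k)

  ∸-suc : ∀ {k d} → k < d → d ∸ k ≡ suc (d ∸ suc k)
  ∸-suc (s≤s k≤d) = +-∸-assoc 1 k≤d

  ancestor-parent : ∀ {k x} → k < depth x → ancestor k (parent x) ≡ ancestor k x
  ancestor-parent {k} {x} k<d = sym (begin
    iterate parent x (depth x ∸ k)                   ≡⟨ cong (iterate parent x) (∸-suc k<d) ⟩
    iterate parent (parent x) (depth x ∸ suc k)      ≡⟨ cong (λ d → iterate parent (parent x) (d ∸ suc k)) (sym pd) ⟩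
    iterate parent (parent x) (depth (parent x) ∸ k) ∎)
    where
    open ≡-Reasoning
    pd : suc (depth (parent x)) ≡ depth x
    pd = parent-depth x (≤-trans (s≤s z≤n) k<d)

  ancestor-suc : ∀ {k x} → k < depth x → parent (ancestor (suc k) x) ≡ ancestor k x
  ancestor-suc {k} {x} k<d =
    trans (sym (iterate-suc (depth x ∸ suc k) x)) (cong (iterate parent x) (sym (∸-suc k<d)))

  ancestor-adj : ∀ {k x} → k < depth x → Adj (ancestor (suc k) x) (ancestor k x)
  ancestor-adj {k} {x} k<d = subst (Adj _) (ancestor-suc k<d)
    (parent-adj _ (≤-trans (s≤s z≤n) (≤-reflexive (sym (depth-ancestor k<d)))))

  module TreeMoves {U : Vertex → Set} (U-deep : ∀ {x} → U x → 0 < depth x)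
                   (tree-edges : ∀ {x y} → Adj x y → U x → U y → parent x ≡ y ⊎ parent y ≡ x) where

    depth-move : ∀ {r r′} → Move G r r′ → U r → U r′ → depth r ≤ suc (depth r′)
    depth-move (inj₁ refl) _ _ = n≤1+n _
    depth-move {r} {r′} (inj₂ adj) u u′ with tree-edges adj u u′
    ... | inj₁ refl = ≤-reflexive (sym (parent-depth r (U-deep u)))
    ... | inj₂ refl = ≤-trans (n≤1+n (depth r)) (≤-trans (≤-reflexive (parent-depth r′ (U-deep u′))) (n≤1+n _))

    ancestor-move : ∀ {k r r′} → Move G r r′ → U r → U r′ → k ≤ depth r → k ≤ depth r′ →
                    ancestor k r′ ≡ ancestor k r
    ancestor-move (inj₁ refl) _ _ _ _ = refl
    ancestor-move {k} {r} {r′} (inj₂ adj) u u′ k≤d k≤d′ with tree-edges adj u u′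
    ... | inj₁ refl = ancestor-parent (≤-trans (s≤s k≤d′) (≤-reflexive (parent-depth r (U-deep u))))
    ... | inj₂ refl = sym (ancestor-parent (≤-trans (s≤s k≤d) (≤-reflexive (parent-depth r′ (U-deep u′)))))

-- Facts about the concrete graph are proved as decide d refl, which runs the decision
-- procedure d during type checking.

decide : ∀ {A : Set} (a? : Dec A) → does a? ≡ true → A
decide (yes a) _  = a
decide (no _)  ()

all-indexed? : ∀ {n} {A : Set} {Q : Fin n → A → Set} (xs : Vec A n) →
               (∀ i a → Dec (Q i a)) → Dec (∀ i → Q i (lookup xs i))
all-indexed? []       Q? = yes λ ()
all-indexed? (a ∷ as) Q? = map′ (λ (q , qs) → λ { zero → q ; (suc i) → qs i })
                                (λ q → q zero , q ∘ suc)
                                (Q? zero a ×-dec all-indexed? as (Q? ∘ suc))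

at-most-one : ∀ {A : Set} {P : A → Set} (P? : U.Decidable P) {xs} →
              AllPairs (λ x y → ¬ (P x × P y)) xs → length (filter P? xs) ≤ 1
at-most-one P? [] = z≤n
at-most-one P? {x ∷ _} (x-excl ∷ excl) with P? x
... | yes px = s≤s (≤-reflexive (cong length (filter-none P? (LAll.map (λ ¬both py → ¬both (px , py)) x-excl))))
... | no  _  = at-most-one P? excl

module _ {A : Set} {P Q : A → Set} (P? : U.Decidable P) (Q? : U.Decidable Q) where

  pigeonhole-count : ∀ xs → length (filter P? xs) + length (filter Q? xs) < length xs →
                     LAny.Any (λ x → ¬ P x × ¬ Q x) xs
  pigeonhole-count (x ∷ xs) bound with P? x | Q? x
  ... | no ¬p | no ¬q = LAny.here (¬p , ¬q)
  ... | yes _ | no _  = LAny.there (pigeonhole-count xs (≤-pred bound))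
  ... | no _  | yes _ = LAny.there (pigeonhole-count xs (≤-pred (≤-trans (≤-reflexive (cong suc q-last)) bound)))
    where q-last = sym (+-suc (length (filter P? xs)) (length (filter Q? xs)))
  ... | yes _ | yes _ = LAny.there (pigeonhole-count xs (≤-trans (s≤s (+-monoʳ-≤ _ (n≤1+n _))) (≤-pred bound)))

  pigeonhole : ∀ {xs} → AllPairs (λ x y → ¬ (P x × P y)) xs → AllPairs (λ x y → ¬ (Q x × Q y)) xs →
               2 < length xs → LAny.Any (λ x → ¬ P x × ¬ Q x) xs
  pigeonhole P-excl Q-excl 2<n =
    pigeonhole-count _ (≤-trans (s≤s (+-mono-≤ (at-most-one P? P-excl) (at-most-one Q? Q-excl))) 2<n)

fromMaybe-find : ∀ {A : Set} {P Q : A → Set} (P? : U.Decidable P) {x} ys →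
                 Q x → LAll.All Q ys → Q (fromMaybe x (List.find P? ys))
fromMaybe-find P? []       qx LAll.[]         = qx
fromMaybe-find P? (y ∷ ys) qx (qy LAll.∷ qys) with does (P? y)
... | true  = qy
... | false = fromMaybe-find P? ys qx qys

along : ∀ {A : Set} → A → List A → ℕ → A
along x []       _       = x
along x (y ∷ ys) zero    = x
along x (y ∷ ys) (suc i) = along y ys i

along-linked : ∀ {A : Set} {R : A → A → Set} → (∀ x → R x x) →
               ∀ {x xs} → Linked R (x ∷ xs) → ∀ i → R (along x xs i) (along x xs (suc i))
along-linked R-refl {x} [-]                       i       = R-refl x
along-linked R-refl {xs = _ ∷ []}    (xRy ∷ _)    zero    = xRy
along-linked R-refl {xs = _ ∷ _ ∷ _} (xRy ∷ _)    zero    = xRy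
along-linked R-refl                  (_ ∷ linked) (suc i) = along-linked R-refl linked i

module Subdivision {n m k : ℕ} (E : Vec (Fin n × Fin n) m) where
  private
    S : Set
    S = SubVertex n m (suc k)

  _≟ᵛ_ : DecidableEquality S
  orig u  ≟ᵛ orig v  = map′ (cong orig) (λ { refl → refl }) (u ≟ v)
  mid e i ≟ᵛ mid f j = map′ (λ { (refl , refl) → refl }) (λ { refl → refl , refl }) ((e ≟ f) ×-dec (i ≟ j))
  orig _  ≟ᵛ mid _ _ = no λ ()
  mid _ _ ≟ᵛ orig _  = no λ ()

  all-vertices? : {P : S → Set} → U.Decidable P → Dec (∀ x → P x)
  all-vertices? P? = map′ (λ (po , pm) → λ { (orig u) → po u ; (mid e i) → pm e i })
                          (λ p → p ∘ orig , λ e i → p (mid e i))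
                          (all? (P? ∘ orig) ×-dec all? λ e → all? λ i → P? (mid e i))

  SubStep? : B.Decidable (SubStep E)
  SubStep? (orig u) (orig v) = no λ ()
  SubStep? (orig u) (mid e i) with u ≟ proj₁ (lookup E e) | toℕ i ℕ.≟ 0
  ... | yes refl | yes i≡0 = yes (first e i i≡0)
  ... | no u≢    | _       = no λ { (first _ _ _) → u≢ refl }
  ... | yes _    | no i≢0  = no λ { (first _ _ i≡0) → i≢0 i≡0 }
  SubStep? (mid e i) (mid f j) with e ≟ f | toℕ j ℕ.≟ suc (toℕ i)
  ... | yes refl | yes j≡1+i = yes (next e i j j≡1+i)
  ... | no e≢f   | _         = no λ { (next _ _ _ _) → e≢f refl }
  ... | yes _    | no j≢1+i  = no λ { (next _ _ _ j≡1+i) → j≢1+i j≡1+i }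
  SubStep? (mid e i) (orig v) with proj₂ (lookup E e) ≟ v | suc (toℕ i) ℕ.≟ suc k
  ... | yes refl | yes i≡k = yes (last e i i≡k)
  ... | no v≢    | _       = no λ { (last _ _ _) → v≢ refl }
  ... | yes _    | no i≢k  = no λ { (last _ _ i≡k) → i≢k i≡k }

  SubAdj? : B.Decidable (SubAdj E)
  SubAdj? x y = SubStep? x y ⊎-dec SubStep? y x

  subStep-elim : {P : S → S → Set} →
                 (∀ e → P (orig (proj₁ (lookup E e))) (mid e zero)) →
                 (∀ e i → P (mid e (inject₁ i)) (mid e (suc i))) →
                 (∀ e → P (mid e (fromℕ k)) (orig (proj₂ (lookup E e)))) →
                 ∀ {x y} → SubStep E x y → P x y
  subStep-elim {P} P-first P-next P-last (first e i i≡0) =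
    subst (λ i → P _ (mid e i)) (sym (toℕ-injective {j = zero} i≡0)) (P-first e)
  subStep-elim {P} P-first P-next P-last (next e i (suc j) 1+j≡1+i) =
    subst (λ i → P (mid e i) _) (toℕ-injective (trans (toℕ-inject₁ j) (suc-injective 1+j≡1+i))) (P-next e j)
  subStep-elim {P} P-first P-next P-last (last e i 1+i≡1+k) =
    subst (λ i → P (mid e i) _) (toℕ-injective (trans (toℕ-fromℕ k) (sym (suc-injective 1+i≡1+k)))) (P-last e)

  all-steps? : {P : S → S → Set} → B.Decidable P → Dec (∀ {x y} → SubStep E x y → P x y)
  all-steps? {P} P? =
    map′ (λ (P-first , P-next , P-last) → subStep-elim {P} P-first P-next P-last)
         (λ P-step → (λ e → P-step (first e zero refl))
                   , (λ e i → P-step (next e (inject₁ i) (suc i) (cong suc (sym (toℕ-inject₁ i)))))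
                   , (λ e → P-step (last e (fromℕ k) (cong suc (toℕ-fromℕ k)))))
         (all? (λ e → P? _ _) ×-dec (all? λ e → all? λ i → P? _ _) ×-dec all? (λ e → P? _ _))

-- The subdivided dodecahedron

V : Set
V = SubVertex 20 30 14

open Graph G₁₅ using (Adj)
open Game G₁₅
open Subdivision {k = 13} dodecaEdges

Move? : B.Decidable (Move G₁₅)
Move? x y = (x ≟ᵛ y) ⊎-dec SubAdj? x y

source target : Fin 30 → Fin 20
source e = proj₁ (lookup dodecaEdges e)
target e = proj₂ (lookup dodecaEdges e)

-- Distances in the dodecahedron.  Nothing relies on this table beyond the properties of dist
-- checked below; dist uses the builtin-backed minimum ⊓′ since it is evaluated very often.

dodecaDistances : Vec (Vec ℕ 20) 20
dodecaDistances =
  (0 ∷ 1 ∷ 2 ∷ 2 ∷ 1 ∷ 1 ∷ 2 ∷ 2 ∷ 3 ∷ 3 ∷ 4 ∷ 3 ∷ 3 ∷ 2 ∷ 2 ∷ 3 ∷ 4 ∷ 5 ∷ 4 ∷ 3 ∷ []) ∷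
  (1 ∷ 0 ∷ 1 ∷ 2 ∷ 2 ∷ 2 ∷ 2 ∷ 1 ∷ 2 ∷ 2 ∷ 3 ∷ 3 ∷ 4 ∷ 3 ∷ 3 ∷ 3 ∷ 3 ∷ 4 ∷ 5 ∷ 4 ∷ []) ∷
  (2 ∷ 1 ∷ 0 ∷ 1 ∷ 2 ∷ 3 ∷ 3 ∷ 2 ∷ 2 ∷ 1 ∷ 2 ∷ 2 ∷ 3 ∷ 3 ∷ 4 ∷ 4 ∷ 3 ∷ 3 ∷ 4 ∷ 5 ∷ []) ∷
  (2 ∷ 2 ∷ 1 ∷ 0 ∷ 1 ∷ 3 ∷ 4 ∷ 3 ∷ 3 ∷ 2 ∷ 2 ∷ 1 ∷ 2 ∷ 2 ∷ 3 ∷ 5 ∷ 4 ∷ 3 ∷ 3 ∷ 4 ∷ []) ∷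
  (1 ∷ 2 ∷ 2 ∷ 1 ∷ 0 ∷ 2 ∷ 3 ∷ 3 ∷ 4 ∷ 3 ∷ 3 ∷ 2 ∷ 2 ∷ 1 ∷ 2 ∷ 4 ∷ 5 ∷ 4 ∷ 3 ∷ 3 ∷ []) ∷
  (1 ∷ 2 ∷ 3 ∷ 3 ∷ 2 ∷ 0 ∷ 1 ∷ 2 ∷ 3 ∷ 4 ∷ 5 ∷ 4 ∷ 3 ∷ 2 ∷ 1 ∷ 2 ∷ 3 ∷ 4 ∷ 3 ∷ 2 ∷ []) ∷
  (2 ∷ 2 ∷ 3 ∷ 4 ∷ 3 ∷ 1 ∷ 0 ∷ 1 ∷ 2 ∷ 3 ∷ 4 ∷ 5 ∷ 4 ∷ 3 ∷ 2 ∷ 1 ∷ 2 ∷ 3 ∷ 3 ∷ 2 ∷ []) ∷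
  (2 ∷ 1 ∷ 2 ∷ 3 ∷ 3 ∷ 2 ∷ 1 ∷ 0 ∷ 1 ∷ 2 ∷ 3 ∷ 4 ∷ 5 ∷ 4 ∷ 3 ∷ 2 ∷ 2 ∷ 3 ∷ 4 ∷ 3 ∷ []) ∷
  (3 ∷ 2 ∷ 2 ∷ 3 ∷ 4 ∷ 3 ∷ 2 ∷ 1 ∷ 0 ∷ 1 ∷ 2 ∷ 3 ∷ 4 ∷ 5 ∷ 4 ∷ 2 ∷ 1 ∷ 2 ∷ 3 ∷ 3 ∷ []) ∷
  (3 ∷ 2 ∷ 1 ∷ 2 ∷ 3 ∷ 4 ∷ 3 ∷ 2 ∷ 1 ∷ 0 ∷ 1 ∷ 2 ∷ 3 ∷ 4 ∷ 5 ∷ 3 ∷ 2 ∷ 2 ∷ 3 ∷ 4 ∷ []) ∷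
  (4 ∷ 3 ∷ 2 ∷ 2 ∷ 3 ∷ 5 ∷ 4 ∷ 3 ∷ 2 ∷ 1 ∷ 0 ∷ 1 ∷ 2 ∷ 3 ∷ 4 ∷ 3 ∷ 2 ∷ 1 ∷ 2 ∷ 3 ∷ []) ∷
  (3 ∷ 3 ∷ 2 ∷ 1 ∷ 2 ∷ 4 ∷ 5 ∷ 4 ∷ 3 ∷ 2 ∷ 1 ∷ 0 ∷ 1 ∷ 2 ∷ 3 ∷ 4 ∷ 3 ∷ 2 ∷ 2 ∷ 3 ∷ []) ∷
  (3 ∷ 4 ∷ 3 ∷ 2 ∷ 2 ∷ 3 ∷ 4 ∷ 5 ∷ 4 ∷ 3 ∷ 2 ∷ 1 ∷ 0 ∷ 1 ∷ 2 ∷ 3 ∷ 3 ∷ 2 ∷ 1 ∷ 2 ∷ []) ∷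
  (2 ∷ 3 ∷ 3 ∷ 2 ∷ 1 ∷ 2 ∷ 3 ∷ 4 ∷ 5 ∷ 4 ∷ 3 ∷ 2 ∷ 1 ∷ 0 ∷ 1 ∷ 3 ∷ 4 ∷ 3 ∷ 2 ∷ 2 ∷ []) ∷
  (2 ∷ 3 ∷ 4 ∷ 3 ∷ 2 ∷ 1 ∷ 2 ∷ 3 ∷ 4 ∷ 5 ∷ 4 ∷ 3 ∷ 2 ∷ 1 ∷ 0 ∷ 2 ∷ 3 ∷ 3 ∷ 2 ∷ 1 ∷ []) ∷
  (3 ∷ 3 ∷ 4 ∷ 5 ∷ 4 ∷ 2 ∷ 1 ∷ 2 ∷ 2 ∷ 3 ∷ 3 ∷ 4 ∷ 3 ∷ 3 ∷ 2 ∷ 0 ∷ 1 ∷ 2 ∷ 2 ∷ 1 ∷ []) ∷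
  (4 ∷ 3 ∷ 3 ∷ 4 ∷ 5 ∷ 3 ∷ 2 ∷ 2 ∷ 1 ∷ 2 ∷ 2 ∷ 3 ∷ 3 ∷ 4 ∷ 3 ∷ 1 ∷ 0 ∷ 1 ∷ 2 ∷ 2 ∷ []) ∷
  (5 ∷ 4 ∷ 3 ∷ 3 ∷ 4 ∷ 4 ∷ 3 ∷ 3 ∷ 2 ∷ 2 ∷ 1 ∷ 2 ∷ 2 ∷ 3 ∷ 3 ∷ 2 ∷ 1 ∷ 0 ∷ 1 ∷ 2 ∷ []) ∷
  (4 ∷ 5 ∷ 4 ∷ 3 ∷ 3 ∷ 3 ∷ 3 ∷ 4 ∷ 3 ∷ 3 ∷ 2 ∷ 2 ∷ 1 ∷ 2 ∷ 2 ∷ 2 ∷ 2 ∷ 1 ∷ 0 ∷ 1 ∷ []) ∷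
  (3 ∷ 4 ∷ 5 ∷ 4 ∷ 3 ∷ 2 ∷ 2 ∷ 3 ∷ 3 ∷ 4 ∷ 3 ∷ 3 ∷ 2 ∷ 2 ∷ 1 ∷ 1 ∷ 2 ∷ 2 ∷ 1 ∷ 0 ∷ []) ∷ []

dodecaDist : Fin 20 → Fin 20 → ℕ
dodecaDist u w = lookup (lookup dodecaDistances u) w

dist : Fin 20 → V → ℕ
dist w (orig u)  = 15 * dodecaDist u w
dist w (mid e i) = (15 * dodecaDist (source e) w + suc (toℕ i)) ⊓′ (15 * dodecaDist (target e) w + (14 ∸ toℕ i))

before : Fin 30 → Fin 14 → V
before e zero    = orig (source e)
before e (suc i) = mid e (inject₁ i)

after : Fin 30 → Fin 14 → V
after e i with suc (toℕ i) <? 14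
... | yes i+1<14 = mid e (fromℕ< i+1<14)
... | no  _      = orig (target e)

-- For each dodecahedron neighbour v of u, the pair of v and the first vertex on the way to it.

branches : Fin 20 → List (Fin 20 × V)
branches u = concatMap leaving (allFin 30)
  where
  leaving : Fin 30 → List (Fin 20 × V)
  leaving e = (if does (source e ≟ u) then [ target e , mid e zero ] else [])
           ++ (if does (target e ≟ u) then [ source e , mid e (fromℕ 13) ] else [])

neighbours : V → List V
neighbours (orig u)  = List.map proj₂ (branches u)
neighbours (mid e i) = before e i ∷ after e i ∷ []

towards : Fin 20 → V → V
towards w x = fromMaybe x (List.find (λ y → dist w y <? dist w x) (neighbours x))

dist-lipschitz-step : ∀ w {x y} → SubStep dodecaEdges x y → dist w x ≤ suc (dist w y) × dist w y ≤ suc (dist w x)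
dist-lipschitz-step = decide (all? λ w → all-steps? λ x y →
  (dist w x ≤? suc (dist w y)) ×-dec (dist w y ≤? suc (dist w x))) refl

dist-lipschitz : ∀ w {x y} → Move G₁₅ x y → dist w x ≤ suc (dist w y)
dist-lipschitz w (inj₁ refl)       = n≤1+n _
dist-lipschitz w (inj₂ (inj₁ x→y)) = proj₁ (dist-lipschitz-step w x→y)
dist-lipschitz w (inj₂ (inj₂ y→x)) = proj₂ (dist-lipschitz-step w y→x)

neighbours-adjacent : ∀ x → LAll.All (Adj x) (neighbours x)
neighbours-adjacent = decide (all-vertices? λ x → LAll.all? (SubAdj? x) (neighbours x)) refl

towards-move : ∀ w x → Move G₁₅ x (towards w x)
towards-move w x = fromMaybe-find {Q = Move G₁₅ x} (λ y → dist w y <? dist w x) (neighbours x)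
                                  (inj₁ refl) (LAll.map inj₂ (neighbours-adjacent x))

towards-closer : ∀ w x → dist w (towards w x) ≤ pred (dist w x)
towards-closer = decide (all? λ w → all-vertices? λ x → dist w (towards w x) ≤? pred (dist w x)) refl

approach : ∀ w {n} x → dist w x ≤ suc n → ∃[ y ] Move G₁₅ x y × dist w y ≤ n
approach w x x≤1+n = towards w x , towards-move w x , ≤-trans (towards-closer w x) (pred-mono-≤ x≤1+n)

dist-zero : ∀ w x → dist w x ≡ 0 → x ≡ orig w
dist-zero = decide (all? λ w → all-vertices? λ x → (dist w x ℕ.≟ 0) →-dec (x ≟ᵛ orig w)) refl

dist-home : ∀ w → dist w (orig w) ≡ 0
dist-home = decide (all? λ w → dist w (orig w) ℕ.≟ 0) refl

dist-bounded : ∀ w x → dist w x ≤ 75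
dist-bounded = decide (all? λ w → all-vertices? λ x → dist w x ≤? 75) refl

-- Two cops lose

branch-count : ∀ w → length (branches w) ≡ 3
branch-count = decide (all? λ w → length (branches w) ℕ.≟ 3) refl

branches-lead-away : ∀ w → LAll.All (λ (v , y) → Adj (orig w) y × dist v y ≤ 14) (branches w)
branches-lead-away = decide (all? λ w →
  LAll.all? (λ (v , y) → SubAdj? (orig w) y ×-dec (dist v y ≤? 14)) (branches w)) refl

near : ℕ → V → Fin 20 → Set
near n c v = dist v c ≤ n

near? : ∀ n c → U.Decidable (near n c)
near? n c v = dist v c ≤? n

cop-blocks-one-branch : ∀ w → AllPairs (λ (v , _) (v′ , _) → ∀ c → 1 ≤ dist w c → ¬ (near 15 c v × near 15 c v′))
                                       (branches w)
cop-blocks-one-branch = decide (all? λ w → allPairs? (λ (v , _) (v′ , _) → all-vertices? λ c →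
  (1 ≤? dist w c) →-dec ¬? (near? 15 c v ×-dec near? 15 c v′)) (branches w)) refl

starts : List (Fin 20)
starts = # 0 ∷ # 1 ∷ # 2 ∷ []

cop-near-one-start : AllPairs (λ v v′ → ∀ c → ¬ (near 1 c v × near 1 c v′)) starts
cop-near-one-start = decide (allPairs? (λ v v′ → all-vertices? λ c → ¬? (near? 1 c v ×-dec near? 1 c v′)) starts) refl

module Robber = Evasion G₁₅ dist

branch-escape : ∀ w r (cs : Vec V 2) → dist w r ≡ 0 → All (λ c → 1 ≤ dist w c) cs →
                ∃[ n ] ∃[ w′ ] ∃[ r′ ] Move G₁₅ r r′ × Robber.Safe n w′ cs r′
branch-escape w r (c₁ ∷ c₂ ∷ []) r-home (c₁-away ∷ c₂-away ∷ []) =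
  let (w→y , y-near) , (c₁-far , c₂-far) = LAll.lookupAny (branches-lead-away w) free
      (v , y) = LAny.lookup free
  in 14 , v , y , subst (λ r → Move G₁₅ r y) (sym (dist-zero w r r-home)) (inj₂ w→y)
   , y-near , ≰⇒> c₁-far ∷ ≰⇒> c₂-far ∷ []
  where
  free : LAny.Any (λ (v , _) → ¬ near 15 c₁ v × ¬ near 15 c₂ v) (branches w)
  free = pigeonhole (near? 15 c₁ ∘ proj₁) (near? 15 c₂ ∘ proj₁)
           (AllPairs.map (λ excl → excl c₁ c₁-away) (cop-blocks-one-branch w))
           (AllPairs.map (λ excl → excl c₂ c₂-away) (cop-blocks-one-branch w))
           (≤-reflexive (sym (branch-count w)))

safe-start : ∀ (cs : Vec V 2) → ∃[ w ] ∃[ r ] Robber.Safe 0 w cs r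
safe-start (c₁ ∷ c₂ ∷ []) =
  let w , c₁-far , c₂-far = LAny.satisfied (pigeonhole (near? 1 c₁) (near? 1 c₂)
                              (AllPairs.map (λ excl → excl c₁) cop-near-one-start)
                              (AllPairs.map (λ excl → excl c₂) cop-near-one-start) ≤-refl)
  in w , orig w , ≤-reflexive (dist-home w) , ≰⇒> c₁-far ∷ ≰⇒> c₂-far ∷ []

two-cops-lose : ¬ CopsWin G₁₅ 2
two-cops-lose = Robber.robber-wins dist-lipschitz approach branch-escape safe-start

-- Three cops win

crossing : Fin 30 → List V
crossing e = List.map (mid e) (allFin 14) ++ [ orig (target e) ]

-- Each guard patrols a geodesic of length 75 between antipodal branch vertices: 0 to 17 and 3 to 15.

route₁ route₂ : List V
route₁ = concatMap crossing (# 0 ∷ # 1 ∷ # 7 ∷ # 14 ∷ # 22 ∷ [])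
route₂ = concatMap crossing (# 3 ∷ # 9 ∷ # 18 ∷ # 24 ∷ # 29 ∷ [])

guard₁ guard₂ : ℕ → V
guard₁ = along (orig (# 0)) route₁
guard₂ = along (orig (# 3)) route₂

guard₁-moves : ∀ i → Move G₁₅ (guard₁ i) (guard₁ (suc i))
guard₁-moves = along-linked (λ _ → inj₁ refl) (decide (linked? Move? (orig (# 0) ∷ route₁)) refl)

guard₂-moves : ∀ i → Move G₁₅ (guard₂ i) (guard₂ (suc i))
guard₂-moves = along-linked (λ _ → inj₁ refl) (decide (linked? Move? (orig (# 3) ∷ route₂)) refl)

module Guard₁ = Shadowing G₁₅ 75 guard₁ guard₁-moves (dist (# 0)) (dist-lipschitz (# 0))
module Guard₂ = Shadowing G₁₅ 75 guard₂ guard₂-moves (dist (# 3)) (dist-lipschitz (# 3))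

Guarded : V → Set
Guarded r = guard₁ (Guard₁.shadow r) ≡ r ⊎ guard₂ (Guard₂.shadow r) ≡ r

Guarded? : U.Decidable Guarded
Guarded? r = (guard₁ (Guard₁.shadow r) ≟ᵛ r) ⊎-dec (guard₂ (Guard₂.shadow r) ≟ᵛ r)

-- The unguarded vertices form a forest rooted at guarded branch vertices of depth 0.  The
-- interior of edge e hangs from its end lookup rootSide e; the entries of rootSide for guarded
-- edges and of parentOrig for vertices of depth 0 are never used.

data Side : Set where
  atSource atTarget : Side

rootSide : Vec Side 30
rootSide =
  atSource ∷ atSource ∷ atSource ∷ atSource ∷ atSource ∷
  atSource ∷ atTarget ∷ atSource ∷ atSource ∷ atSource ∷
  atSource ∷ atSource ∷ atSource ∷ atSource ∷ atSource ∷
  atTarget ∷ atSource ∷ atSource ∷ atSource ∷ atTarget ∷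
  atSource ∷ atSource ∷ atSource ∷ atSource ∷ atSource ∷
  atTarget ∷ atSource ∷ atTarget ∷ atSource ∷ atSource ∷ []

depthOrig : Vec ℕ 20
depthOrig =
  0 ∷ 0 ∷ 0 ∷ 0 ∷ 0 ∷ 15 ∷ 30 ∷ 45 ∷ 60 ∷ 0 ∷ 0 ∷ 15 ∷ 30 ∷ 0 ∷ 0 ∷ 0 ∷ 75 ∷ 0 ∷ 45 ∷ 0 ∷ []

parentOrig : Vec V 20
parentOrig =
  orig (# 0) ∷ orig (# 1) ∷ orig (# 2) ∷ orig (# 3) ∷ orig (# 4) ∷
  mid (# 5) (# 13) ∷ mid (# 10) (# 13) ∷ mid (# 11) (# 13) ∷ mid (# 12) (# 13) ∷ orig (# 9) ∷
  orig (# 10) ∷ mid (# 8) (# 13) ∷ mid (# 16) (# 13) ∷ orig (# 13) ∷ orig (# 14) ∷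
  orig (# 15) ∷ mid (# 21) (# 13) ∷ orig (# 17) ∷ mid (# 23) (# 13) ∷ orig (# 19) ∷ []

parent : V → V
parent (orig u)  = lookup parentOrig u
parent (mid e i) with lookup rootSide e
... | atSource = before e i
... | atTarget = after e i

depth : V → ℕ
depth (orig u)  = lookup depthOrig u
depth (mid e i) with lookup rootSide e
... | atSource = lookup depthOrig (source e) + suc (toℕ i)
... | atTarget = lookup depthOrig (target e) + (14 ∸ toℕ i)

parent-step : ∀ x → 0 < depth x → Adj x (parent x) × suc (depth (parent x)) ≡ depth x
parent-step = decide (all-vertices? λ x →
  (0 <? depth x) →-dec (SubAdj? x (parent x) ×-dec (suc (depth (parent x)) ℕ.≟ depth x))) refl

unguarded-depth : ∀ x → ¬ Guarded x → 0 < depth x × depth x ≤ 89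
unguarded-depth = decide (all-vertices? λ x → ¬? (Guarded? x) →-dec ((0 <? depth x) ×-dec (depth x ≤? 89))) refl

unguarded-steps : ∀ {x y} → SubStep dodecaEdges x y → ¬ Guarded x → ¬ Guarded y → parent x ≡ y ⊎ parent y ≡ x
unguarded-steps = decide (all-steps? λ x y →
  ¬? (Guarded? x) →-dec (¬? (Guarded? y) →-dec ((parent x ≟ᵛ y) ⊎-dec (parent y ≟ᵛ x)))) refl

unguarded-tree : ∀ {x y} → Adj x y → ¬ Guarded x → ¬ Guarded y → parent x ≡ y ⊎ parent y ≡ x
unguarded-tree (inj₁ x→y) u u′ = unguarded-steps x→y u u′
unguarded-tree (inj₂ y→x) u u′ = swap (unguarded-steps y→x u′ u)

open Forest G₁₅ parent depth (λ x → proj₁ ∘ parent-step x) (λ x → proj₂ ∘ parent-step x)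
open TreeMoves {U = ¬_ ∘ Guarded} (proj₁ ∘ unguarded-depth _) unguarded-tree

origin : V → Fin 20
origin (orig u)  = u
origin (mid e _) = source e

rootOf : V → Fin 20
rootOf x = origin (ancestor 0 x)

rooted : ∀ x → ¬ Guarded x → ancestor 0 x ≡ orig (rootOf x)
rooted = decide (all-vertices? λ x → ¬? (Guarded? x) →-dec (ancestor 0 x ≟ᵛ orig (rootOf x))) refl

cops : ℕ → ℕ → V → Vec V 3
cops c₁ c₂ x = guard₁ c₁ ∷ guard₂ c₂ ∷ x ∷ []

Guarding : ℕ → ℕ → V → Set
Guarding c₁ c₂ r = Guard₁.Shadowing 0 c₁ r × Guard₂.Shadowing 0 c₂ r

next₁ next₂ : ℕ → V → ℕ
next₁ = Guard₁.nextIndex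
next₂ = Guard₂.nextIndex

guards-move : ∀ {t c₁ c₂ x x′ r} → Guard₁.Shadowing t c₁ r → Guard₂.Shadowing t c₂ r → Move G₁₅ x x′ →
              Pointwise (Move G₁₅) (cops c₁ c₂ x) (cops (next₁ c₁ r) (next₂ c₂ r) x′)
guards-move s₁ s₂ mv = Guard₁.shadowing-move s₁ ∷ Guard₂.shadowing-move s₂ ∷ mv ∷ []

guarding-step : ∀ {c₁ c₂ r r′} → Guarding c₁ c₂ r → Move G₁₅ r r′ → Guarding (next₁ c₁ r) (next₂ c₂ r) r′
guarding-step (s₁ , s₂) mv = Guard₁.shadowing-step s₁ mv , Guard₂.shadowing-step s₂ mv

capture-guarded : ∀ {n c₁ c₂ r} x → Guarding c₁ c₂ r → Guarded r → CopsWinWithin G₁₅ (suc n) (cops c₁ c₂ x) r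
capture-guarded {c₁ = c₁} {c₂} {r} x (s₁ , s₂) guarded =
  inj₂ (cops (next₁ c₁ r) (next₂ c₂ r) x , guards-move s₁ s₂ (inj₁ refl) , inj₁ (caught guarded))
  where
  caught : Guarded r → Caught G₁₅ (cops (next₁ c₁ r) (next₂ c₂ r) x) r
  caught (inj₁ on₁) = here (sym (trans (cong guard₁ (Guard₁.shadowing-settled s₁)) on₁))
  caught (inj₂ on₂) = there (here (sym (trans (cong guard₂ (Guard₂.shadowing-settled s₂)) on₂)))

capture-by-third : ∀ {n c₁ c₂ x r} → Guarding c₁ c₂ r → Move G₁₅ x r → CopsWinWithin G₁₅ (suc n) (cops c₁ c₂ x) r
capture-by-third {c₁ = c₁} {c₂} {r = r} (s₁ , s₂) mv =
  inj₂ (cops (next₁ c₁ r) (next₂ c₂ r) r , guards-move s₁ s₂ mv , inj₁ (there (there (here refl))))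

guarded-round : ∀ {n c₁ c₂ x x′ r} → Guarding c₁ c₂ r → Move G₁₅ x x′ →
                (∀ {r′} → Move G₁₅ r r′ → ¬ Guarded r′ → Guarding (next₁ c₁ r) (next₂ c₂ r) r′ →
                   CopsWinWithin G₁₅ (suc n) (cops (next₁ c₁ r) (next₂ c₂ r) x′) r′) →
                CopsWinWithin G₁₅ (suc (suc n)) (cops c₁ c₂ x) r
guarded-round {n} {c₁} {c₂} {x} {x′} {r} g@(s₁ , s₂) mv continue =
  inj₂ (cops (next₁ c₁ r) (next₂ c₂ r) x′ , guards-move s₁ s₂ mv , inj₂ respond)
  where
  respond : ∀ r′ → Move G₁₅ r r′ → CopsWinWithin G₁₅ (suc n) (cops (next₁ c₁ r) (next₂ c₂ r) x′) r′
  respond r′ mv′ = by-cases (Guarded? r′)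
    where
    by-cases : Dec (Guarded r′) → CopsWinWithin G₁₅ (suc n) (cops (next₁ c₁ r) (next₂ c₂ r) x′) r′
    by-cases (yes guarded) = capture-guarded x′ (guarding-step g mv′) guarded
    by-cases (no  u′)      = continue mv′ u′ (guarding-step g mv′)

chase : ∀ n k {c₁ c₂ r} → Guarding c₁ c₂ r → ¬ Guarded r → k < depth r → 89 ≤ k + n →
        CopsWinWithin G₁₅ (suc n) (cops c₁ c₂ (ancestor k r)) r
chase zero k {r = r} g u k<d bound =
  ⊥-elim (<⇒≱ k<d (≤-trans (proj₂ (unguarded-depth r u)) (≤-trans bound (≤-reflexive (+-identityʳ k)))))
chase (suc n) k {c₁} {c₂} {r} g u k<d bound = by-depth (depth r ℕ.≟ suc k)
  where
  by-depth : Dec (depth r ≡ suc k) → CopsWinWithin G₁₅ (suc (suc n)) (cops c₁ c₂ (ancestor k r)) r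
  by-depth (yes d≡1+k) = capture-by-third g
    (Move-sym (inj₂ (subst (λ a → Adj a (ancestor k r)) (ancestor-self d≡1+k) (ancestor-adj k<d))))
  by-depth (no  d≢1+k) = guarded-round g (Move-sym (inj₂ (ancestor-adj k<d))) continue
    where
    1+k<d : suc k < depth r
    1+k<d = ≤∧≢⇒< k<d (d≢1+k ∘ sym)
    continue : ∀ {r′} → Move G₁₅ r r′ → ¬ Guarded r′ → Guarding (next₁ c₁ r) (next₂ c₂ r) r′ →
               CopsWinWithin G₁₅ (suc n) (cops (next₁ c₁ r) (next₂ c₂ r) (ancestor (suc k) r)) r′
    continue {r′} mv u′ g′ = follow (depth r′ ℕ.≟ suc k)
      where
      1+k≤d′ : suc k ≤ depth r′
      1+k≤d′ = ≤-pred (≤-trans 1+k<d (depth-move mv u u′))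
      same : ancestor (suc k) r′ ≡ ancestor (suc k) r
      same = ancestor-move mv u u′ (<⇒≤ 1+k<d) 1+k≤d′
      follow : Dec (depth r′ ≡ suc k) →
               CopsWinWithin G₁₅ (suc n) (cops (next₁ c₁ r) (next₂ c₂ r) (ancestor (suc k) r)) r′
      follow (yes d′≡1+k) =
        CopsWinWithin-caught (suc n) (there (there (here (trans (sym (ancestor-self d′≡1+k)) same))))
      follow (no  d′≢1+k) =
        subst (λ a → CopsWinWithin G₁₅ (suc n) (cops (next₁ c₁ r) (next₂ c₂ r) a) r′) same
              (chase n (suc k) g′ u′ (≤∧≢⇒< 1+k≤d′ (d′≢1+k ∘ sym)) (≤-trans bound (≤-reflexive (+-suc k n))))

walk : ∀ d {c₁ c₂ x r} → Guarding c₁ c₂ r → ¬ Guarded r → dist (rootOf r) x ≤ d →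
       CopsWinWithin G₁₅ (suc d + 89) (cops c₁ c₂ x) r
walk zero {c₁} {c₂} {x} {r} g u x-home =
  subst (λ a → CopsWinWithin G₁₅ 90 (cops c₁ c₂ a) r) at-root
        (chase 89 0 g u (proj₁ (unguarded-depth r u)) ≤-refl)
  where
  at-root : ancestor 0 r ≡ x
  at-root = trans (rooted r u) (sym (dist-zero (rootOf r) x (n≤0⇒n≡0 x-home)))
walk (suc d) {c₁} {c₂} {x} {r} g u x-near = guarded-round g (towards-move (rootOf r) x) continue
  where
  continue : ∀ {r′} → Move G₁₅ r r′ → ¬ Guarded r′ → Guarding (next₁ c₁ r) (next₂ c₂ r) r′ →
             CopsWinWithin G₁₅ (suc d + 89) (cops (next₁ c₁ r) (next₂ c₂ r) (towards (rootOf r) x)) r′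
  continue {r′} mv u′ g′ = walk d g′ u′
    (subst (λ w → dist w (towards (rootOf r) x) ≤ d) (cong origin (sym (ancestor-move mv u u′ z≤n z≤n)))
           (≤-trans (towards-closer (rootOf r) x) (pred-mono-≤ x-near)))

guarding-phase : ∀ {c₁ c₂ r} x → Guarding c₁ c₂ r → CopsWinWithin G₁₅ (suc 75 + 89) (cops c₁ c₂ x) r
guarding-phase {c₁} {c₂} {r} x g = by-cases (Guarded? r)
  where
  by-cases : Dec (Guarded r) → CopsWinWithin G₁₅ (suc 75 + 89) (cops c₁ c₂ x) r
  by-cases (yes guarded) = capture-guarded {n = 75 + 89} x g guarded
  by-cases (no  u)       = walk 75 g u (dist-bounded (rootOf r) x)

approach-phase : ∀ t {c₁ c₂ r} x → Guard₁.Shadowing t c₁ r → Guard₂.Shadowing t c₂ r →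
                 CopsWinWithin G₁₅ (t + (suc 75 + 89)) (cops c₁ c₂ x) r
approach-phase zero    x s₁ s₂ = guarding-phase x (s₁ , s₂)
approach-phase (suc t) {c₁} {c₂} {r} x s₁ s₂ =
  inj₂ (cops (next₁ c₁ r) (next₂ c₂ r) x , guards-move s₁ s₂ (inj₁ refl) ,
        inj₂ λ r′ mv → approach-phase t x (Guard₁.shadowing-step s₁ mv) (Guard₂.shadowing-step s₂ mv))

three-cops-win : CopsWin G₁₅ 3
three-cops-win = cops 0 0 (orig (# 0)) , 75 + (suc 75 + 89) ,
                 λ r → approach-phase 75 (orig (# 0)) (Guard₁.shadowing-start r) (Guard₂.shadowing-start r)

-- A unit-disk drawing: unit distance 100, so the threshold is 100² = 10000; the coordinates are
-- shifted to be nonnegative.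

origPositions : Vec (ℕ × ℕ) 20
origPositions =
  (1110 , 2219) ∷ (54 , 1452) ∷ (457 , 211) ∷ (1763 , 211) ∷ (2166 , 1452) ∷
  (1090 , 1903) ∷ (534 , 1910) ∷ (318 , 1385) ∷ (149 , 808) ∷ (628 , 436) ∷
  (1124 , 133) ∷ (1579 , 417) ∷ (2074 , 803) ∷ (1880 , 1347) ∷ (1698 , 1928) ∷
  (883 , 1455) ∷ (729 , 1000) ∷ (1106 , 697) ∷ (1507 , 971) ∷ (1364 , 1435) ∷ []

midPositions : Vec (Vec (ℕ × ℕ) 14) 30
midPositions =
  ((1017 , 2215) ∷ (925 , 2204) ∷ (834 , 2184) ∷ (745 , 2157) ∷ (658 , 2123) ∷ (575 , 2082) ∷ (496 , 2034) ∷ (420 , 1979) ∷ (350 , 1918) ∷ (285 , 1852) ∷ (226 , 1780) ∷ (173 , 1704) ∷ (126 , 1623) ∷ (87 , 1539) ∷ []) ∷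
  ((29 , 1362) ∷ (12 , 1271) ∷ (2 , 1179) ∷ (0 , 1086) ∷ (6 , 993) ∷ (20 , 901) ∷ (41 , 810) ∷ (70 , 722) ∷ (106 , 636) ∷ (149 , 554) ∷ (198 , 475) ∷ (255 , 401) ∷ (317 , 332) ∷ (385 , 269) ∷ []) ∷
  ((535 , 159) ∷ (616 , 115) ∷ (701 , 77) ∷ (789 , 46) ∷ (879 , 23) ∷ (971 , 8) ∷ (1064 , 0) ∷ (1156 , 0) ∷ (1249 , 8) ∷ (1341 , 23) ∷ (1431 , 46) ∷ (1519 , 77) ∷ (1604 , 115) ∷ (1685 , 159) ∷ []) ∷
  ((1835 , 269) ∷ (1903 , 332) ∷ (1965 , 401) ∷ (2022 , 475) ∷ (2071 , 554) ∷ (2114 , 636) ∷ (2150 , 722) ∷ (2179 , 810) ∷ (2200 , 901) ∷ (2214 , 993) ∷ (2220 , 1086) ∷ (2218 , 1179) ∷ (2208 , 1271) ∷ (2191 , 1362) ∷ []) ∷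
  ((2133 , 1539) ∷ (2094 , 1623) ∷ (2047 , 1704) ∷ (1994 , 1780) ∷ (1935 , 1852) ∷ (1870 , 1918) ∷ (1800 , 1979) ∷ (1724 , 2034) ∷ (1645 , 2082) ∷ (1562 , 2123) ∷ (1475 , 2157) ∷ (1386 , 2184) ∷ (1295 , 2204) ∷ (1203 , 2215) ∷ []) ∷
  ((1106 , 2159) ∷ (1067 , 2123) ∷ (1096 , 2055) ∷ (1184 , 2089) ∷ (1199 , 2104) ∷ (1289 , 2099) ∷ (1305 , 2099) ∷ (1392 , 2078) ∷ (1374 , 2020) ∷ (1309 , 1994) ∷ (1272 , 1995) ∷ (1204 , 1986) ∷ (1168 , 1979) ∷ (1116 , 1929) ∷ []) ∷
  ((113 , 1437) ∷ (157 , 1431) ∷ (193 , 1370) ∷ (130 , 1330) ∷ (114 , 1301) ∷ (107 , 1227) ∷ (106 , 1196) ∷ (98 , 1123) ∷ (127 , 1093) ∷ (201 , 1153) ∷ (210 , 1204) ∷ (229 , 1272) ∷ (265 , 1294) ∷ (298 , 1361) ∷ []) ∷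
  ((489 , 262) ∷ (485 , 314) ∷ (580 , 315) ∷ (594 , 248) ∷ (624 , 219) ∷ (684 , 195) ∷ (721 , 180) ∷ (779 , 151) ∷ (826 , 171) ∷ (790 , 259) ∷ (761 , 277) ∷ (685 , 310) ∷ (681 , 344) ∷ (637 , 403) ∷ []) ∷
  ((1724 , 257) ∷ (1677 , 271) ∷ (1694 , 358) ∷ (1770 , 351) ∷ (1799 , 367) ∷ (1848 , 422) ∷ (1870 , 444) ∷ (1919 , 499) ∷ (1914 , 540) ∷ (1819 , 536) ∷ (1778 , 500) ∷ (1725 , 458) ∷ (1680 , 462) ∷ (1611 , 422) ∷ []) ∷
  ((2110 , 1430) ∷ (2088 , 1382) ∷ (2012 , 1392) ∷ (2022 , 1487) ∷ (2032 , 1501) ∷ (1995 , 1588) ∷ (1992 , 1598) ∷ (1944 , 1680) ∷ (1898 , 1652) ∷ (1887 , 1583) ∷ (1898 , 1547) ∷ (1917 , 1482) ∷ (1921 , 1445) ∷ (1905 , 1378) ∷ []) ∷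
  ((1016 , 1963) ∷ (999 , 1955) ∷ (994 , 1861) ∷ (976 , 1853) ∷ (903 , 1913) ∷ (879 , 1893) ∷ (886 , 1799) ∷ (881 , 1788) ∷ (797 , 1744) ∷ (789 , 1839) ∷ (772 , 1846) ∷ (699 , 1784) ∷ (666 , 1872) ∷ (618 , 1954) ∷ []) ∷
  ((446 , 1875) ∷ (472 , 1783) ∷ (501 , 1717) ∷ (495 , 1655) ∷ (526 , 1597) ∷ (579 , 1518) ∷ (485 , 1500) ∷ (474 , 1505) ∷ (419 , 1582) ∷ (380 , 1583) ∷ (371 , 1489) ∷ (361 , 1480) ∷ (266 , 1476) ∷ (258 , 1459) ∷ []) ∷
  ((400 , 1336) ∷ (389 , 1307) ∷ (461 , 1248) ∷ (440 , 1215) ∷ (345 , 1212) ∷ (317 , 1174) ∷ (395 , 1120) ∷ (400 , 1108) ∷ (375 , 1017) ∷ (302 , 1070) ∷ (280 , 1062) ∷ (282 , 967) ∷ (187 , 972) ∷ (125 , 900) ∷ []) ∷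
  ((215 , 740) ∷ (310 , 734) ∷ (398 , 770) ∷ (411 , 677) ∷ (430 , 670) ∷ (497 , 736) ∷ (533 , 648) ∷ (529 , 636) ∷ (462 , 570) ∷ (467 , 552) ∷ (561 , 536) ∷ (568 , 522) ∷ (522 , 439) ∷ (534 , 423) ∷ []) ∷
  ((716 , 473) ∷ (723 , 481) ∷ (749 , 572) ∷ (821 , 520) ∷ (815 , 425) ∷ (837 , 407) ∷ (911 , 467) ∷ (924 , 465) ∷ (987 , 394) ∷ (916 , 338) ∷ (919 , 314) ∷ (1011 , 292) ∷ (987 , 230) ∷ (1030 , 146) ∷ []) ∷
  ((1218 , 115) ∷ (1230 , 209) ∷ (1220 , 267) ∷ (1281 , 335) ∷ (1286 , 349) ∷ (1278 , 444) ∷ (1369 , 419) ∷ (1376 , 404) ∷ (1383 , 310) ∷ (1417 , 288) ∷ (1473 , 365) ∷ (1486 , 367) ∷ (1562 , 310) ∷ (1581 , 322) ∷ []) ∷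
  ((1549 , 507) ∷ (1564 , 523) ∷ (1526 , 609) ∷ (1581 , 626) ∷ (1663 , 578) ∷ (1690 , 590) ∷ (1670 , 683) ∷ (1674 , 696) ∷ (1754 , 746) ∷ (1771 , 657) ∷ (1797 , 650) ∷ (1857 , 718) ∷ (1919 , 712) ∷ (2011 , 737) ∷ []) ∷
  ((2080 , 898) ∷ (2010 , 962) ∷ (1933 , 939) ∷ (1924 , 1034) ∷ (1907 , 1041) ∷ (1817 , 1014) ∷ (1827 , 1109) ∷ (1834 , 1118) ∷ (1925 , 1145) ∷ (1929 , 1163) ∷ (1854 , 1221) ∷ (1857 , 1240) ∷ (1948 , 1266) ∷ (1952 , 1284) ∷ []) ∷
  ((1802 , 1401) ∷ (1792 , 1421) ∷ (1697 , 1408) ∷ (1687 , 1424) ∷ (1732 , 1507) ∷ (1721 , 1525) ∷ (1627 , 1510) ∷ (1616 , 1524) ∷ (1653 , 1612) ∷ (1663 , 1618) ∷ (1746 , 1661) ∷ (1674 , 1723) ∷ (1750 , 1771) ∷ (1769 , 1864) ∷ []) ∷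
  ((1619 , 1980) ∷ (1561 , 1919) ∷ (1497 , 1849) ∷ (1493 , 1839) ∷ (1473 , 1747) ∷ (1384 , 1715) ∷ (1381 , 1798) ∷ (1390 , 1820) ∷ (1336 , 1893) ∷ (1300 , 1875) ∷ (1277 , 1783) ∷ (1248 , 1771) ∷ (1198 , 1852) ∷ (1151 , 1830) ∷ []) ∷
  ((551 , 1874) ∷ (575 , 1807) ∷ (595 , 1778) ∷ (622 , 1713) ∷ (598 , 1673) ∷ (631 , 1608) ∷ (657 , 1587) ∷ (727 , 1651) ∷ (745 , 1645) ∷ (756 , 1551) ∷ (772 , 1543) ∷ (851 , 1596) ∷ (879 , 1559) ∷ (863 , 1491) ∷ []) ∷
  ((214 , 845) ∷ (229 , 876) ∷ (319 , 845) ∷ (331 , 851) ∷ (398 , 915) ∷ (412 , 917) ∷ (484 , 855) ∷ (502 , 862) ∷ (510 , 957) ∷ (527 , 964) ∷ (599 , 902) ∷ (617 , 910) ∷ (624 , 1004) ∷ (681 , 993) ∷ []) ∷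
  ((1131 , 175) ∷ (1099 , 235) ∷ (1115 , 278) ∷ (1137 , 333) ∷ (1165 , 371) ∷ (1087 , 425) ∷ (1090 , 444) ∷ (1179 , 477) ∷ (1181 , 495) ∷ (1102 , 548) ∷ (1104 , 567) ∷ (1193 , 600) ∷ (1192 , 627) ∷ (1115 , 671) ∷ []) ∷
  ((1992 , 840) ∷ (1978 , 845) ∷ (1890 , 818) ∷ (1876 , 821) ∷ (1833 , 906) ∷ (1818 , 909) ∷ (1744 , 850) ∷ (1726 , 858) ∷ (1722 , 953) ∷ (1705 , 961) ∷ (1631 , 901) ∷ (1613 , 908) ∷ (1607 , 1003) ∷ (1530 , 972) ∷ []) ∷
  ((1666 , 1886) ∷ (1663 , 1829) ∷ (1594 , 1809) ∷ (1575 , 1771) ∷ (1570 , 1707) ∷ (1563 , 1667) ∷ (1548 , 1605) ∷ (1461 , 1643) ∷ (1446 , 1631) ∷ (1466 , 1538) ∷ (1451 , 1526) ∷ (1365 , 1565) ∷ (1334 , 1548) ∷ (1370 , 1460) ∷ []) ∷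
  ((802 , 1406) ∷ (799 , 1381) ∷ (885 , 1341) ∷ (927 , 1269) ∷ (890 , 1237) ∷ (803 , 1276) ∷ (750 , 1258) ∷ (722 , 1210) ∷ (808 , 1171) ∷ (895 , 1132) ∷ (904 , 1092) ∷ (813 , 1066) ∷ (726 , 1105) ∷ (712 , 1093) ∷ []) ∷
  ((739 , 905) ∷ (757 , 899) ∷ (827 , 962) ∷ (916 , 988) ∷ (925 , 924) ∷ (855 , 861) ∷ (846 , 817) ∷ (909 , 769) ∷ (953 , 823) ∷ (1023 , 887) ∷ (1041 , 880) ∷ (1051 , 786) ∷ (1008 , 734) ∷ (1012 , 689) ∷ []) ∷
  ((1186 , 749) ∷ (1189 , 762) ∷ (1139 , 843) ∷ (1156 , 914) ∷ (1195 , 932) ∷ (1244 , 851) ∷ (1293 , 770) ∷ (1351 , 822) ∷ (1349 , 859) ∷ (1299 , 940) ∷ (1310 , 956) ∷ (1404 , 948) ∷ (1451 , 881) ∷ (1483 , 879) ∷ []) ∷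
  ((1469 , 1058) ∷ (1458 , 1064) ∷ (1365 , 1046) ∷ (1300 , 1096) ∷ (1300 , 1128) ∷ (1394 , 1147) ∷ (1487 , 1165) ∷ (1466 , 1253) ∷ (1423 , 1248) ∷ (1329 , 1229) ∷ (1318 , 1244) ∷ (1358 , 1330) ∷ (1434 , 1358) ∷ (1446 , 1388) ∷ []) ∷
  ((1269 , 1431) ∷ (1259 , 1422) ∷ (1253 , 1327) ∷ (1206 , 1286) ∷ (1156 , 1286) ∷ (1163 , 1381) ∷ (1169 , 1476) ∷ (1087 , 1478) ∷ (1073 , 1435) ∷ (1066 , 1340) ∷ (1022 , 1315) ∷ (976 , 1394) ∷ (983 , 1489) ∷ (967 , 1499) ∷ []) ∷ []

position : V → ℕ × ℕ
position (orig u)  = lookup origPositions u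
position (mid e i) = lookup (lookup midPositions e) i

-- Walks the position tables instead of looking positions up, which keeps the check of all
-- 440² pairs of vertices below fast.

all-positioned? : {Q : V → ℕ × ℕ → Set} → (∀ x p → Dec (Q x p)) → Dec (∀ x → Q x (position x))
all-positioned? Q? = map′ (λ (Qo , Qm) → λ { (orig u) → Qo u ; (mid e i) → Qm e i })
                          (λ Q → Q ∘ orig , λ e i → Q (mid e i))
                          (all-indexed? origPositions (Q? ∘ orig) ×-dec
                           all-indexed? midPositions λ e row → all-indexed? row λ i → Q? (mid e i))

-- ∣ a - c ∣ in builtin arithmetic (the library's ∣_-_∣ recurses on unary numerals).

gap : ℕ → ℕ → ℕ
gap a c = (a ∸ c) + (c ∸ a)

sqDist : ℕ × ℕ → ℕ × ℕ → ℕ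
sqDist (a , b) (c , d) = gap a c * gap a c + gap b d * gap b d

steps-short : ∀ {x y} → SubStep dodecaEdges x y →
              sqDist (position x) (position y) ≤ 10000 × sqDist (position y) (position x) ≤ 10000
steps-short = decide (all-steps? λ x y →
  (sqDist (position x) (position y) ≤? 10000) ×-dec (sqDist (position y) (position x) ≤? 10000)) refl

FarOrAdjacent : V → V → Set
FarOrAdjacent x y = 10000 < sqDist (position x) (position y) ⊎ x ≡ y
                  ⊎ (0 < sqDist (position x) (position y) × Adj x y)

far-or-adjacent : ∀ x y → FarOrAdjacent x y
far-or-adjacent = decide (all-positioned? λ x p → all-positioned? λ y q →
  (10000 <? sqDist p q) ⊎-dec (x ≟ᵛ y) ⊎-dec ((0 <? sqDist p q) ×-dec SubAdj? x y)) refl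

ι : ℕ → ℚ
ι n = mkℚ (+ n) 0 (Coprime.sym (Coprime.1-coprimeTo n))

ιᵘ : ℕ → ℚᵘ
ιᵘ n = ℚᵘ.mkℚᵘ (+ n) 0

dist²ᵘ : ℚᵘ × ℚᵘ → ℚᵘ × ℚᵘ → ℚᵘ
dist²ᵘ (a , b) (c , d) = (a ℚᵘ.- c) ℚᵘ.* (a ℚᵘ.- c) ℚᵘ.+ (b ℚᵘ.- d) ℚᵘ.* (b ℚᵘ.- d)

toℚᵘ-dist² : ∀ a b c d → toℚᵘ (dist² (a , b) (c , d)) ℚᵘ.≃ dist²ᵘ (toℚᵘ a , toℚᵘ b) (toℚᵘ c , toℚᵘ d)
toℚᵘ-dist² a b c d = ℚᵘ.≃-trans (ℚ.toℚᵘ-homo-+ ((a ℚ.- c) ℚ.* (a ℚ.- c)) ((b ℚ.- d) ℚ.* (b ℚ.- d)))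
                                (ℚᵘ.+-cong (toℚᵘ-square a c) (toℚᵘ-square b d))
  where
  toℚᵘ-diff : ∀ p q → toℚᵘ (p ℚ.- q) ℚᵘ.≃ toℚᵘ p ℚᵘ.- toℚᵘ q
  toℚᵘ-diff p q = ℚᵘ.≃-trans (ℚ.toℚᵘ-homo-+ p (ℚ.- q)) (ℚᵘ.+-congʳ (toℚᵘ p) (ℚ.toℚᵘ-homo‿- q))
  toℚᵘ-square : ∀ p q → toℚᵘ ((p ℚ.- q) ℚ.* (p ℚ.- q)) ℚᵘ.≃ (toℚᵘ p ℚᵘ.- toℚᵘ q) ℚᵘ.* (toℚᵘ p ℚᵘ.- toℚᵘ q)
  toℚᵘ-square p q = ℚᵘ.≃-trans (ℚ.toℚᵘ-homo-* (p ℚ.- q) (p ℚ.- q)) (ℚᵘ.*-cong (toℚᵘ-diff p q) (toℚᵘ-diff p q))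

∣⊖∣≡gap : ∀ a c → ℤ.∣ a ⊖ c ∣ ≡ gap a c
∣⊖∣≡gap a c with a ≤? c
... | yes a≤c = trans (ℤ.∣⊖∣-≤ a≤c) (cong (_+ (c ∸ a)) (sym (m≤n⇒m∸n≡0 a≤c)))
... | no  a≰c = trans (ℤ.∣m⊖n∣≡∣n⊖m∣ a c) (trans (ℤ.∣⊖∣-≤ c≤a)
                  (trans (sym (+-identityʳ (a ∸ c))) (cong (λ z → (a ∸ c) + z) (sym (m≤n⇒m∸n≡0 c≤a)))))
  where c≤a = <⇒≤ (≰⇒> a≰c)

square-diff : ∀ a c → (+ a ℤ.- + c) ℤ.* (+ a ℤ.- + c) ≡ + (gap a c * gap a c)
square-diff a c rewrite ℤ.m-n≡m⊖n a c | sym (∣⊖∣≡gap a c) = square (a ⊖ c)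
  where
  square : ∀ i → i ℤ.* i ≡ + (ℤ.∣ i ∣ * ℤ.∣ i ∣)
  square (+ n)    = ℤ.+◃n≡+n (n * n)
  square -[1+ n ] = ℤ.+◃n≡+n (suc n * suc n)

dist²ᵘ-ι : ∀ a b c d → dist²ᵘ (ιᵘ a , ιᵘ b) (ιᵘ c , ιᵘ d) ℚᵘ.≃ ιᵘ (sqDist (a , b) (c , d))
dist²ᵘ-ι a b c d = ℚᵘ.*≡* (begin
  ℚᵘ.↥ (dist²ᵘ (ιᵘ a , ιᵘ b) (ιᵘ c , ιᵘ d)) ℤ.* + 1
    ≡⟨ expand (+ a) (+ b) (+ c) (+ d) ⟩
  (+ a ℤ.- + c) ℤ.* (+ a ℤ.- + c) ℤ.+ (+ b ℤ.- + d) ℤ.* (+ b ℤ.- + d)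
    ≡⟨ cong₂ ℤ._+_ (square-diff a c) (square-diff b d) ⟩
  + sqDist (a , b) (c , d)
    ≡⟨ sym (ℤ.*-identityʳ _) ⟩
  + sqDist (a , b) (c , d) ℤ.* + 1 ∎)
  where
  open ≡-Reasoning
  open ℤ-Solver
  expand : ∀ a b c d → _ ≡ (a ℤ.- c) ℤ.* (a ℤ.- c) ℤ.+ (b ℤ.- d) ℤ.* (b ℤ.- d)
  expand = solve 4 (λ a b c d →
    (((a :* con (+ 1) :+ (:- c) :* con (+ 1)) :* (a :* con (+ 1) :+ (:- c) :* con (+ 1))) :* con (+ 1)
     :+ ((b :* con (+ 1) :+ (:- d) :* con (+ 1)) :* (b :* con (+ 1) :+ (:- d) :* con (+ 1))) :* con (+ 1)) :* con (+ 1)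
    := (a :- c) :* (a :- c) :+ (b :- d) :* (b :- d)) refl

ιᵘ-≤ : ∀ {m n} → ιᵘ m ℚᵘ.≤ ιᵘ n ⇔ m ≤ n
ιᵘ-≤ {m} {n} = mk⇔ (λ { (ℚᵘ.*≤* le) → ℤ.drop‿+≤+ (subst₂ ℤ._≤_ (ℤ.*-identityʳ (+ m)) (ℤ.*-identityʳ (+ n)) le) })
                   (λ m≤n → ℚᵘ.*≤* (subst₂ ℤ._≤_ (sym (ℤ.*-identityʳ (+ m))) (sym (ℤ.*-identityʳ (+ n))) (ℤ.+≤+ m≤n)))

close-iff : ∀ p q s → dist² (ι (proj₁ p) , ι (proj₂ p)) (ι (proj₁ q) , ι (proj₂ q)) ≤ℚ ι s ⇔ sqDist p q ≤ s
close-iff (a , b) (c , d) s = mk⇔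
  (λ le → Equivalence.to ιᵘ-≤ (ℚᵘ.≤-respˡ-≃ embed-≃ (ℚ.toℚᵘ-mono-≤ le)))
  (λ le → ℚ.toℚᵘ-cancel-≤ (ℚᵘ.≤-respˡ-≃ (ℚᵘ.≃-sym embed-≃) (Equivalence.from ιᵘ-≤ le)))
  where
  embed-≃ : toℚᵘ (dist² (ι a , ι b) (ι c , ι d)) ℚᵘ.≃ ιᵘ (sqDist (a , b) (c , d))
  embed-≃ = ℚᵘ.≃-trans (toℚᵘ-dist² (ι a) (ι b) (ι c) (ι d)) (dist²ᵘ-ι a b c d)

embed : V → Point
embed x = ι (proj₁ (position x)) , ι (proj₂ (position x))

sqDist-self : ∀ p → sqDist p p ≡ 0
sqDist-self (a , b) rewrite n∸n≡0 a | n∸n≡0 b = refl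

ι-injective : ∀ {m n} → ι m ≡ ι n → m ≡ n
ι-injective = ℤ.+-injective ∘ cong ℚ.numerator

embed-injective : ∀ x y → embed x ≡ embed y → x ≡ y
embed-injective x y same = by-cases (far-or-adjacent x y)
  where
  coincide : sqDist (position x) (position y) ≡ 0
  coincide = trans (cong (sqDist (position x)) (sym (cong₂ _,_ (ι-injective (cong proj₁ same))
                                                               (ι-injective (cong proj₂ same)))))
                   (sqDist-self (position x))
  by-cases : FarOrAdjacent x y → x ≡ y
  by-cases (inj₁ far)              = ⊥-elim (<⇒≱ far (≤-trans (≤-reflexive coincide) z≤n))
  by-cases (inj₂ (inj₁ x≡y))       = x≡y
  by-cases (inj₂ (inj₂ (apart , _))) = ⊥-elim (<-irrefl (sym coincide) apart)

geometric : HasGeometricRepresentation G₁₅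
geometric = embed , ι 10000 , ℚ.*<* (ℤ.+<+ (s≤s z≤n)) , embed-injective , adjacent-iff-close
  where
  adjacent-iff-close : ∀ x y → x ≢ y → Adj x y ⇔ (dist² (embed x) (embed y) ≤ℚ ι 10000)
  adjacent-iff-close x y x≢y = mk⇔ close adjacent
    where
    close-iff′ = close-iff (position x) (position y) 10000
    close : Adj x y → dist² (embed x) (embed y) ≤ℚ ι 10000
    close (inj₁ x→y) = Equivalence.from close-iff′ (proj₁ (steps-short x→y))
    close (inj₂ y→x) = Equivalence.from close-iff′ (proj₂ (steps-short y→x))
    by-cases : dist² (embed x) (embed y) ≤ℚ ι 10000 → FarOrAdjacent x y → Adj x y
    by-cases le (inj₁ far)              = ⊥-elim (<⇒≱ far (Equivalence.to close-iff′ le))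
    by-cases le (inj₂ (inj₁ x≡y))       = ⊥-elim (x≢y x≡y)
    by-cases le (inj₂ (inj₂ (_ , adj))) = adj
    adjacent : dist² (embed x) (embed y) ≤ℚ ι 10000 → Adj x y
    adjacent le = by-cases le (far-or-adjacent x y)

theoremC : CopNumberIs G₁₅ 3 × HasGeometricRepresentation G₁₅
theoremC = copNumber (orig (# 0)) three-cops-win two-cops-lose , geometric
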